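{- Let $G=(K,I;E)$ be a split graph, $c\ge1$ and $k\ge0$ integers. If $S$ is a $c$-colorable set of $G$ with $|S|\ge k$, then there is a $\mathsf{TAR}_k$-sequence between $S$ and $T_{S\cap K}$.
   Context: A split graph $G=(K,I;E)$ has vertex set partitioned into a clique $K$ and an independent set $I$. A set $S\subseteq V(G)$ is $c$-colorable if $G[S]$ has a proper $c$-coloring. For $C \subseteq K$ with $|C|\le c$, define $T_C = C \cup I$ if $|C|<c$, and $T_C = (C\cup I)\setminus\{u \in I : C \subseteq N_G(u)\}$ if $|C|=c$, where $N_G(u)$ is the neighborhood of $u$. For $c$-colorable sets $S,T$, $S \leftrightarrow T$ under $\mathsf{TAR}_k$ means $|S|,|T|\ge k$ and $|S\triangle T|=1$; a $\mathsf{TAR}_k$-sequence between $S_0$ and $S_\ell$ is a sequence $\langle S_0,\dots,S_\ell\rangle$ of $c$-colorable sets with $S_{i-1}\leftrightarrow S_i$ under $\mathsf{TAR}_k$ for all $i$. -}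

module Defs where

open import Data.Nat using (ℕ; _≤_; _<_; _<?_)
open import Data.Bool using (Bool; true; false; _∨_; _∧_; not)
open import Data.Fin using (Fin)
open import Data.Fin.Subset using (Subset; _∈_; _∉_; _∩_; _∪_; _─_; ∣_∣; _⊆_)
open import Data.Fin.Subset.Properties using (_⊆?_; _∈?_)
open import Data.Vec using (tabulate)
open import Data.Product using (Σ; _×_)
open import Relation.Nullary using (¬_)
open import Relation.Nullary.Decidable using (⌊_⌋)
open import Relation.Binary.PropositionalEquality using (_≡_)
open import Relation.Binary.Construct.Closure.ReflexiveTransitive using (Star)

record Graph (n : ℕ) : Set where
  field
    adj     : Fin n → Fin n → Bool
    sym     : ∀ u v → adj u v ≡ adj v u
    irrefl  : ∀ v → adj v v ≡ false

open Graph public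

Adj : ∀ {n} → Graph n → Fin n → Fin n → Set
Adj G u v = adj G u v ≡ true

N : ∀ {n} → Graph n → Fin n → Subset n
N G u = tabulate (adj G u)

record IsSplit {n : ℕ} (G : Graph n) (K : Subset n) : Set where
  field
    clique      : ∀ u v → u ∈ K → v ∈ K → ¬ (u ≡ v) → Adj G u v
    independent : ∀ u v → u ∉ K → v ∉ K → ¬ Adj G u v

Colorable : ∀ {n} → Graph n → ℕ → Subset n → Set
Colorable G c S =
  Σ (Fin _ → Fin c) λ f → ∀ u v → u ∈ S → v ∈ S → Adj G u v → ¬ (f u ≡ f v)

_△_ : ∀ {n} → Subset n → Subset n → Subset n
S △ T = (S ─ T) ∪ (T ─ S)

TARStep : ∀ {n} → Graph n → ℕ → ℕ → Subset n → Subset n → Set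
TARStep G c k S T =
  Colorable G c S × Colorable G c T × k ≤ ∣ S ∣ × k ≤ ∣ T ∣ × ∣ S △ T ∣ ≡ 1

-- Every set
-- in a sequence of length ≥ 1 is c-colorable through the steps; for l = 0
-- colorability of S_0 has to be supplied separately (see TARSeq).
TARSeq : ∀ {n} → Graph n → ℕ → ℕ → Subset n → Subset n → Set
TARSeq G c k S T = Colorable G c S × Star (TARStep G c k) S T

-- T_C for C ⊆ K, with I = complement of K:
--   T_C = C ∪ I                                    if |C| < c
--   T_C = (C ∪ I) \ {u ∈ I : C ⊆ N_G(u)}           if |C| = c
-- (for |C| = c, C ⊆ K so removing such u only removes vertices of I).
TC : ∀ {n} → Graph n → Subset n → ℕ → Subset n → Subset n
TC G K c C = tabulate λ v →
  ⌊ v ∈? C ⌋ ∨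
  (not ⌊ v ∈? K ⌋ ∧ (⌊ ∣ C ∣ <? c ⌋ ∨ not ⌊ C ⊆? N G v ⌋))

{-# OPTIONS --safe #-}
module Submission where

-- Write C = S ∩ K. Every vertex of S lies in T_C: a vertex of S ∩ I adjacent to all of C
-- would extend the clique C to a clique of size ∣ C ∣ + 1 inside the c-colourable set S,
-- so ∣ C ∣ < c. And T_C is c-colourable: keep the colours of S on C (injective, C being a
-- clique) and give each vertex v of T_C ∖ C, which lies in the independent set I, a colour
-- not used on its neighbours in C: a colour unused on C when ∣ C ∣ < c, and otherwise the
-- colour of a non-neighbour of v in C. Subsets of T_C are then c-colourable as well, so
-- adding the vertices of T_C ∖ S one at a time is a TAR_k-sequence whose sets never shrink
-- below ∣ S ∣ ≥ k.

open import Defs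
open import Data.Nat using (ℕ; _≤_)
open import Data.Fin.Subset using (Subset; _∩_; ∣_∣)

open import Data.Bool using (Bool; true; _∨_; _∧_; not) renaming (_≟_ to _≟ᵇ_)
open import Data.Bool.Properties using (T-≡)
open import Data.Empty using (⊥-elim)
open import Data.Fin using (Fin; zero; suc; _≟_)
open import Data.Fin.Properties using (any?; all?; ¬∀⟶∃¬; suc-injective; 0≢1+n)
open import Data.Fin.Subset using (_∈_; _∉_; _⊆_; _⊂_; _∪_; _-_; ⁅_⁆; ⊤; inside; outside)
  renaming (⊥ to ∅)
open import Data.Fin.Subset.Properties
  using (_∈?_; _⊆?_; ⊆-antisym; p⊂q⇒∣p∣<∣q∣; p⊆p∪q; q⊆p∪q; x∈p∪q⁻; ∣p∣≤∣p∪q∣; ∪-identityʳ;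
         x∈⁅x⁆; x∈⁅y⁆⇒x≡y; ∣⁅x⁆∣≡1; ∣⊤∣≡n; ∈⊤; x∈p∩q⁺; x∈p∩q⁻; x∈p⇒∣p-x∣<∣p∣; x∈p∧x≢y⇒x∈p-y)
open import Data.Nat using (zero; suc; z≤n; _<_; _<?_; _+_)
open import Data.Nat.Properties using (≤-trans; ≤-<-trans; <⇒≱; +-suc; +-monoʳ-≤; m≤m+n)
open import Data.Product using (_×_; _,_; proj₁; proj₂; ∃; map₂)
open import Data.Sum using (_⊎_; inj₁; inj₂)
open import Data.Vec using ([]; _∷_; tabulate; here; there)
open import Data.Vec.Properties using (lookup∘tabulate; []=⇒lookup; lookup⇒[]=)
open import Function using (_∘_; Equivalence)
open import Relation.Nullary using (¬_; Dec; yes; no; ¬?; _×-dec_; _⊎-dec_; _→-dec_)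
open import Relation.Nullary.Decidable
  using (⌊_⌋; isYes≗does; toWitness; fromWitness; decidable-stable)
open import Relation.Binary.PropositionalEquality
  using (_≡_; _≢_; refl; trans; cong; subst) renaming (sym to ≡-sym)
open import Relation.Binary.Construct.Closure.ReflexiveTransitive using (Star; ε; _◅_)

private
  variable
    m l : ℕ

∈tabulate⁺ : (g : Fin m → Bool) {x : Fin m} → g x ≡ true → x ∈ tabulate g
∈tabulate⁺ g {x} gx = lookup⇒[]= x (tabulate g) (trans (lookup∘tabulate g x) gx)

∈tabulate⁻ : (g : Fin m → Bool) {x : Fin m} → x ∈ tabulate g → g x ≡ true
∈tabulate⁻ g {x} x∈ = trans (≡-sym (lookup∘tabulate g x)) ([]=⇒lookup x∈)

⊈⇒∃∈∉ : {p q : Subset m} → ¬ p ⊆ q → ∃ λ x → x ∈ p × x ∉ q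
⊈⇒∃∈∉ {p = p} {q} p⊈q with any? (λ x → x ∈? p ×-dec ¬? (x ∈? q))
... | yes witness = witness
... | no none = ⊥-elim (p⊈q λ {x} x∈p → decidable-stable (x ∈? q) λ x∉q → none (x , x∈p , x∉q))

p⊆q∧∣q∣≤∣p∣⇒p≡q : {p q : Subset m} → p ⊆ q → ∣ q ∣ ≤ ∣ p ∣ → p ≡ q
p⊆q∧∣q∣≤∣p∣⇒p≡q {p = p} {q} p⊆q ∣q∣≤∣p∣ = ⊆-antisym p⊆q (decidable-stable (q ⊆? p) q⊆p)
  where
  q⊆p : ¬ ¬ q ⊆ p
  q⊆p q⊈p with ⊈⇒∃∈∉ q⊈p
  ... | x , x∈q , x∉p = <⇒≱ (p⊂q⇒∣p∣<∣q∣ (p⊆q , x , x∈q , x∉p)) ∣q∣≤∣p∣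

p⊂p∪⁅x⁆ : {p : Subset m} {x : Fin m} → x ∉ p → p ⊂ p ∪ ⁅ x ⁆
p⊂p∪⁅x⁆ {p = p} {x} x∉p = p⊆p∪q ⁅ x ⁆ , x , q⊆p∪q p ⁅ x ⁆ (x∈⁅x⁆ x) , x∉p

p∪⁅x⁆⊆q : {p q : Subset m} {x : Fin m} → p ⊆ q → x ∈ q → p ∪ ⁅ x ⁆ ⊆ q
p∪⁅x⁆⊆q {p = p} {x = x} p⊆q x∈q y∈ with x∈p∪q⁻ p ⁅ x ⁆ y∈
... | inj₁ y∈p = p⊆q y∈p
... | inj₂ y∈⁅x⁆ = subst (_∈ _) (≡-sym (x∈⁅y⁆⇒x≡y x y∈⁅x⁆)) x∈q

p△p≡∅ : (p : Subset m) → p △ p ≡ ∅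
p△p≡∅ []            = refl
p△p≡∅ (inside ∷ p)  = cong (outside ∷_) (p△p≡∅ p)
p△p≡∅ (outside ∷ p) = cong (outside ∷_) (p△p≡∅ p)

p△[p∪⁅x⁆]≡⁅x⁆ : (p : Subset m) {x : Fin m} → x ∉ p → p △ (p ∪ ⁅ x ⁆) ≡ ⁅ x ⁆
p△[p∪⁅x⁆]≡⁅x⁆ (inside ∷ p)  {zero}  x∉p = ⊥-elim (x∉p here)
p△[p∪⁅x⁆]≡⁅x⁆ (outside ∷ p) {zero}  _   =
  cong (inside ∷_) (trans (cong (p △_) (∪-identityʳ p)) (p△p≡∅ p))
p△[p∪⁅x⁆]≡⁅x⁆ (inside ∷ p)  {suc x} x∉p = cong (outside ∷_) (p△[p∪⁅x⁆]≡⁅x⁆ p (x∉p ∘ there))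
p△[p∪⁅x⁆]≡⁅x⁆ (outside ∷ p) {suc x} x∉p = cong (outside ∷_) (p△[p∪⁅x⁆]≡⁅x⁆ p (x∉p ∘ there))

injectiveOn⇒∣p∣≤∣q∣ : {p : Subset m} {q : Subset l} (f : Fin m → Fin l) →
  (∀ {x} → x ∈ p → f x ∈ q) →
  (∀ {x y} → x ∈ p → y ∈ p → f x ≡ f y → x ≡ y) →
  ∣ p ∣ ≤ ∣ q ∣
injectiveOn⇒∣p∣≤∣q∣ {p = []} f maps inj = z≤n
injectiveOn⇒∣p∣≤∣q∣ {p = outside ∷ p} f maps inj =
  injectiveOn⇒∣p∣≤∣q∣ (f ∘ suc) (maps ∘ there) λ x∈ y∈ e → suc-injective (inj (there x∈) (there y∈) e)
injectiveOn⇒∣p∣≤∣q∣ {p = inside ∷ p} {q = q} f maps inj =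
  ≤-<-trans (injectiveOn⇒∣p∣≤∣q∣ {q = q - f zero} (f ∘ suc) maps′ inj′) (x∈p⇒∣p-x∣<∣p∣ (maps here))
  where
  maps′ : ∀ {x} → x ∈ p → f (suc x) ∈ q - f zero
  maps′ x∈ = x∈p∧x≢y⇒x∈p-y (maps (there x∈)) (0≢1+n ∘ inj here (there x∈) ∘ ≡-sym)
  inj′ : ∀ {x y} → x ∈ p → y ∈ p → f (suc x) ≡ f (suc y) → x ≡ y
  inj′ x∈ y∈ e = suc-injective (inj (there x∈) (there y∈) e)

∣p∣<m⇒∃unused : (f : Fin l → Fin m) (p : Subset l) → ∣ p ∣ < m → ∃ λ y → ∀ {x} → x ∈ p → f x ≢ y
∣p∣<m⇒∃unused {m = m} f p ∣p∣<m with all? (λ y → any? (λ x → x ∈? p ×-dec f x ≟ y))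
... | yes hit = ⊥-elim (<⇒≱ ∣p∣<m (subst (_≤ ∣ p ∣) (∣⊤∣≡n m) m≤∣p∣))
  where
  m≤∣p∣ : ∣ ⊤ {m} ∣ ≤ ∣ p ∣
  m≤∣p∣ = injectiveOn⇒∣p∣≤∣q∣ {p = ⊤} {q = p} (proj₁ ∘ hit) (λ {y} _ → proj₁ (proj₂ (hit y)))
    λ {y} {y′} _ _ e → trans (≡-sym (proj₂ (proj₂ (hit y)))) (trans (cong f e) (proj₂ (proj₂ (hit y′))))
... | no ¬hit with ¬∀⟶∃¬ m _ (λ y → any? (λ x → x ∈? p ×-dec f x ≟ y)) ¬hit
... | y , missed = y , λ x∈p fx≡y → missed (_ , x∈p , fx≡y)

module _ {a} {A : Set a} {P : A → Fin m → Set} (P? : ∀ x y → Dec (P x y)) (default : A → Fin m) where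

  select : A → Fin m
  select x with any? (P? x)
  ... | yes (y , _) = y
  ... | no _        = default x

  select-sound : ∀ x → ∃ (P x) → P x (select x)
  select-sound x ∃P with any? (P? x)
  ... | yes (_ , Pxy) = Pxy
  ... | no ¬∃P        = ⊥-elim (¬∃P ∃P)

module _ {n} (G : Graph n) where

  Proper : ∀ {c} → Subset n → (Fin n → Fin c) → Set
  Proper S f = ∀ u v → u ∈ S → v ∈ S → Adj G u v → f u ≢ f v

  IsClique : Subset n → Set
  IsClique D = ∀ u v → u ∈ D → v ∈ D → u ≢ v → Adj G u v

  Adj-sym : ∀ {u v} → Adj G u v → Adj G v u
  Adj-sym {u} {v} uv = trans (sym G v u) uv

  ∈N⁺ : ∀ {u v} → Adj G v u → u ∈ N G v
  ∈N⁺ {v = v} = ∈tabulate⁺ (adj G v)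

  ∈N⁻ : ∀ {u v} → u ∈ N G v → Adj G v u
  ∈N⁻ {v = v} = ∈tabulate⁻ (adj G v)

  colorable-⊆ : ∀ {c A B} → A ⊆ B → Colorable G c B → Colorable G c A
  colorable-⊆ A⊆B (f , proper) = f , λ u v u∈ v∈ → proper u v (A⊆B u∈) (A⊆B v∈)

  proper⇒injectiveOnClique : ∀ {c S D} {f : Fin n → Fin c} → Proper S f → D ⊆ S → IsClique D →
    ∀ {u v} → u ∈ D → v ∈ D → f u ≡ f v → u ≡ v
  proper⇒injectiveOnClique proper D⊆S clique {u} {v} u∈ v∈ fu≡fv with u ≟ v
  ... | yes u≡v = u≡v
  ... | no u≢v  = ⊥-elim (proper u v (D⊆S u∈) (D⊆S v∈) (clique u v u∈ v∈ u≢v) fu≡fv)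

  ∣clique∣≤c : ∀ {c S D} → Colorable G c S → D ⊆ S → IsClique D → ∣ D ∣ ≤ c
  ∣clique∣≤c {c} (f , proper) D⊆S clique =
    subst (_ ≤_) (∣⊤∣≡n c) (injectiveOn⇒∣p∣≤∣q∣ f (λ _ → ∈⊤) (proper⇒injectiveOnClique proper D⊆S clique))

  IsClique-∪⁅⁆ : ∀ {D v} → IsClique D → v ∉ D → D ⊆ N G v → IsClique (D ∪ ⁅ v ⁆)
  IsClique-∪⁅⁆ {D} {v} clique v∉D D⊆Nv x y x∈ y∈ x≢y with x∈p∪q⁻ D ⁅ v ⁆ x∈ | x∈p∪q⁻ D ⁅ v ⁆ y∈
  ... | inj₁ x∈D | inj₁ y∈D = clique x y x∈D y∈D x≢y
  ... | inj₁ x∈D | inj₂ y∈⁅v⁆ rewrite x∈⁅y⁆⇒x≡y v y∈⁅v⁆ = Adj-sym (∈N⁻ (D⊆Nv x∈D))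
  ... | inj₂ x∈⁅v⁆ | inj₁ y∈D rewrite x∈⁅y⁆⇒x≡y v x∈⁅v⁆ = ∈N⁻ (D⊆Nv y∈D)
  ... | inj₂ x∈⁅v⁆ | inj₂ y∈⁅v⁆ = ⊥-elim (x≢y (trans (x∈⁅y⁆⇒x≡y v x∈⁅v⁆) (≡-sym (x∈⁅y⁆⇒x≡y v y∈⁅v⁆))))

  module _ (c k : ℕ) where

    TARStep-insert : ∀ {A B x} → A ⊆ B → Colorable G c B → k ≤ ∣ A ∣ → x ∈ B → x ∉ A →
      TARStep G c k A (A ∪ ⁅ x ⁆)
    TARStep-insert {A} {B} {x} A⊆B colB k≤∣A∣ x∈B x∉A =
      colorable-⊆ A⊆B colB , colorable-⊆ (p∪⁅x⁆⊆q A⊆B x∈B) colB ,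
      k≤∣A∣ , ≤-trans k≤∣A∣ (∣p∣≤∣p∪q∣ A ⁅ x ⁆) ,
      trans (cong ∣_∣ (p△[p∪⁅x⁆]≡⁅x⁆ A x∉A)) (∣⁅x⁆∣≡1 x)

    TARStep*-⊆ : ∀ {A B} → A ⊆ B → Colorable G c B → k ≤ ∣ A ∣ → Star (TARStep G c k) A B
    TARStep*-⊆ {A} {B} = insertAll ∣ B ∣ (m≤m+n ∣ B ∣ ∣ A ∣)
      where
      insertAll : ∀ fuel {A} → ∣ B ∣ ≤ fuel + ∣ A ∣ → A ⊆ B → Colorable G c B → k ≤ ∣ A ∣ →
        Star (TARStep G c k) A B
      insertAll zero {A} bound A⊆B _ _ = subst (Star _ A) (p⊆q∧∣q∣≤∣p∣⇒p≡q A⊆B bound) ε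
      insertAll (suc fuel) {A} bound A⊆B colB k≤∣A∣ with B ⊆? A
      ... | yes B⊆A = subst (Star _ A) (⊆-antisym A⊆B B⊆A) ε
      ... | no B⊈A with ⊈⇒∃∈∉ B⊈A
      ... | x , x∈B , x∉A =
        TARStep-insert A⊆B colB k≤∣A∣ x∈B x∉A ◅
        insertAll fuel bound′ (p∪⁅x⁆⊆q A⊆B x∈B) colB (≤-trans k≤∣A∣ (∣p∣≤∣p∪q∣ A ⁅ x ⁆))
        where
        bound′ : ∣ B ∣ ≤ fuel + ∣ A ∪ ⁅ x ⁆ ∣
        bound′ = ≤-trans bound (subst (_≤ fuel + ∣ A ∪ ⁅ x ⁆ ∣) (+-suc fuel ∣ A ∣)
                   (+-monoʳ-≤ fuel (p⊂q⇒∣p∣<∣q∣ (p⊂p∪⁅x⁆ x∉A))))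

module _ {n} (G : Graph n) (K : Subset n) (c : ℕ) (C : Subset n) where

  InTC : Fin n → Set
  InTC v = v ∈ C ⊎ (v ∉ K × (∣ C ∣ < c ⊎ ¬ C ⊆ N G v))

  inTC? : ∀ v → Dec (InTC v)
  inTC? v = v ∈? C ⊎-dec (¬? (v ∈? K) ×-dec (∣ C ∣ <? c ⊎-dec ¬? (C ⊆? N G v)))

  TC-entry : ∀ v → ⌊ v ∈? C ⌋ ∨ (not ⌊ v ∈? K ⌋ ∧ (⌊ ∣ C ∣ <? c ⌋ ∨ not ⌊ C ⊆? N G v ⌋)) ≡ ⌊ inTC? v ⌋
  TC-entry v rewrite isYes≗does (v ∈? C) | isYes≗does (v ∈? K) | isYes≗does (∣ C ∣ <? c)
                   | isYes≗does (C ⊆? N G v) | isYes≗does (inTC? v) = refl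

  ∈TC⁺ : ∀ {v} → InTC v → v ∈ TC G K c C
  ∈TC⁺ {v} inT = ∈tabulate⁺ _ (trans (TC-entry v) (Equivalence.to T-≡ (fromWitness inT)))

  ∈TC⁻ : ∀ {v} → v ∈ TC G K c C → InTC v
  ∈TC⁻ {v} v∈ = toWitness (Equivalence.from T-≡ (trans (≡-sym (TC-entry v)) (∈tabulate⁻ _ v∈)))

module _ {n} {G : Graph n} {K : Subset n} (split : IsSplit G K) {c : ℕ} {S : Subset n}
         {f : Fin n → Fin c} (proper : Proper G S f) where

  open IsSplit split

  C⊆S : S ∩ K ⊆ S
  C⊆S = proj₁ ∘ x∈p∩q⁻ S K

  C-clique : IsClique G (S ∩ K)
  C-clique u v u∈C v∈C = clique u v (proj₂ (x∈p∩q⁻ S K u∈C)) (proj₂ (x∈p∩q⁻ S K v∈C))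

  C-injective : ∀ {u v} → u ∈ S ∩ K → v ∈ S ∩ K → f u ≡ f v → u ≡ v
  C-injective = proper⇒injectiveOnClique G proper C⊆S C-clique

  ∈S∖K⇒small∨nonadjacent : ∀ {v} → v ∈ S → v ∉ K → ∣ S ∩ K ∣ < c ⊎ ¬ S ∩ K ⊆ N G v
  ∈S∖K⇒small∨nonadjacent {v} v∈S v∉K with S ∩ K ⊆? N G v
  ... | yes C⊆Nv = inj₁ (≤-trans (p⊂q⇒∣p∣<∣q∣ (p⊂p∪⁅x⁆ v∉C))
                     (∣clique∣≤c G (f , proper) (p∪⁅x⁆⊆q C⊆S v∈S) (IsClique-∪⁅⁆ G C-clique v∉C C⊆Nv)))
    where
    v∉C : v ∉ S ∩ K
    v∉C = v∉K ∘ proj₂ ∘ x∈p∩q⁻ S K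
  ... | no C⊈Nv = inj₂ C⊈Nv

  S⊆TC : S ⊆ TC G K c (S ∩ K)
  S⊆TC {v} v∈S with v ∈? K
  ... | yes v∈K = ∈TC⁺ G K c _ (inj₁ (x∈p∩q⁺ (v∈S , v∈K)))
  ... | no v∉K  = ∈TC⁺ G K c _ (inj₂ (v∉K , ∈S∖K⇒small∨nonadjacent v∈S v∉K))

  TC∖C⊆I : ∀ {v} → v ∈ TC G K c (S ∩ K) → v ∉ S ∩ K → v ∉ K
  TC∖C⊆I v∈T v∉C with ∈TC⁻ G K c _ v∈T
  ... | inj₁ v∈C       = ⊥-elim (v∉C v∈C)
  ... | inj₂ (v∉K , _) = v∉K

  Avoids : Fin n → Fin c → Set
  Avoids v y = ∀ u → u ∈ S ∩ K → Adj G u v → f u ≢ y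

  avoids? : ∀ v y → Dec (Avoids v y)
  avoids? v y = all? λ u → u ∈? S ∩ K →-dec (adj G u v ≟ᵇ true →-dec ¬? (f u ≟ y))

  nonneighbour⇒avoids : ∀ {v w} → w ∈ S ∩ K → w ∉ N G v → Avoids v (f w)
  nonneighbour⇒avoids {v} w∈C w∉Nv u u∈C uv fu≡fw =
    w∉Nv (subst (_∈ N G v) (C-injective u∈C w∈C fu≡fw) (∈N⁺ G (Adj-sym G uv)))

  TC∖C⇒∃avoids : ∀ {v} → v ∈ TC G K c (S ∩ K) → v ∉ S ∩ K → ∃ (Avoids v)
  TC∖C⇒∃avoids v∈T v∉C with ∈TC⁻ G K c _ v∈T
  ... | inj₁ v∈C = ⊥-elim (v∉C v∈C)
  ... | inj₂ (_ , inj₁ ∣C∣<c) =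
    map₂ (λ unused u u∈C _ → unused u∈C) (∣p∣<m⇒∃unused f (S ∩ K) ∣C∣<c)
  ... | inj₂ (_ , inj₂ C⊈Nv) with ⊈⇒∃∈∉ C⊈Nv
  ... | w , w∈C , w∉Nv = f w , nonneighbour⇒avoids w∈C w∉Nv

  TC-colorable : Colorable G c (TC G K c (S ∩ K))
  TC-colorable = g , g-proper
    where
    h : Fin n → Fin c
    h = select avoids? f

    g : Fin n → Fin c
    g v with v ∈? S ∩ K
    ... | yes _ = f v
    ... | no _  = h v

    h-avoids : ∀ {v} → v ∈ TC G K c (S ∩ K) → v ∉ S ∩ K → Avoids v (h v)
    h-avoids {v} v∈T v∉C = select-sound avoids? f v (TC∖C⇒∃avoids v∈T v∉C)

    g-proper : Proper G (TC G K c (S ∩ K)) g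
    g-proper u v u∈T v∈T uv with u ∈? S ∩ K | v ∈? S ∩ K
    ... | yes u∈C | yes v∈C = proper u v (C⊆S u∈C) (C⊆S v∈C) uv
    ... | yes u∈C | no v∉C  = h-avoids v∈T v∉C u u∈C uv
    ... | no u∉C  | yes v∈C = h-avoids u∈T u∉C v v∈C (Adj-sym G uv) ∘ ≡-sym
    ... | no u∉C  | no v∉C  = ⊥-elim (independent u v (TC∖C⊆I u∈T u∉C) (TC∖C⊆I v∈T v∉C) uv)

-- The hypothesis 1 ≤ c is deliberately unused: the colouring of S is a function Fin n → Fin c,
-- and it already supplies a colour wherever one is needed (also as the fallback of select).
lemma17 : ∀ {n} (G : Graph n) (K : Subset n) → IsSplit G K →
    (c k : ℕ) → 1 ≤ c → (S : Subset n) → Colorable G c S → k ≤ ∣ S ∣ →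
    TARSeq G c k S (TC G K c (S ∩ K))
lemma17 G K split c k _ S colS@(_ , proper) k≤∣S∣ =
  colS , TARStep*-⊆ G c k (S⊆TC split proper) (TC-colorable split proper) k≤∣S∣
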